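{- Let $(g,f_1,f_2)$ and $(u,v_1,v_2)$ be Sprugnoli arrays and let $m\ge0$ be an integer. Writing $v_2(x)=\sum_{j\ge0}b_{2j+1}x^{2j+1}$, let $w(x)=\sqrt{x}\,v_2(\sqrt{x})=\sum_{j\ge0}b_{2j+1}x^{j+1}$. Then $$(g,f_1,f_2)\cdot\big(u(x)(xv_2(x))^m\big)=\big((g,f_1,f_2)\cdot u\big)\,\big(w(xf_2(x))\big)^m,$$ i.e. $(g,f_1,f_2)\cdot u(x)(xv_2(x))^m=((g,f_1,f_2)\cdot u)\,\big(\sqrt{xf_2}\,v_2(\sqrt{xf_2})\big)^m$.
   Context: All power series are formal power series over a field $\mathbb{K}$ of characteristic $0$. $\mathcal{F}_r$ denotes the set of power series $\sum_{n\ge r}a_nx^n$ with $a_r\ne0$. A Sprugnoli array is a triple $(g,f_1,f_2)$ with $g\in\mathcal{F}_0$, $f_1\in\mathcal{F}_1$, $f_2\in\mathcal{F}_1$ and $f_2$ odd (only odd powers of $x$); its matrix is the lower-triangular matrix $(t_{n,k})_{n,k\ge0}$ with $t_{n,k}=[x^n]\,g(x)f_1(x)^{k\bmod 2}(xf_2(x))^{\lfloor k/2\rfloor}$. For a power series $h=\sum_n a_nx^n$, $(g,f_1,f_2)\cdot h$ denotes the power series $\sum_n\left(\sum_k t_{n,k}a_k\right)x^n$. -}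

module Defs where

open import Level using (Level; _⊔_) renaming (suc to lsuc)
open import Data.Nat using (ℕ; zero; suc; _∸_) renaming (_*_ to _*ℕ_)
open import Data.Nat.DivMod using (_/_; _%_)
open import Data.Product using (_×_; ∃)
open import Relation.Nullary using (¬_)
open import Algebra.Bundles using (CommutativeRing)

record Field (c ℓ : Level) : Set (lsuc (c ⊔ ℓ)) where
  field
    commutativeRing : CommutativeRing c ℓ
  open CommutativeRing commutativeRing public
  field
    0≉1     : ¬ (0# ≈ 1#)
    inverse : ∀ x → ¬ (x ≈ 0#) → ∃ λ y → y * x ≈ 1#

module PowerSeries {c ℓ : Level} (R : CommutativeRing c ℓ) where
  open CommutativeRing R

  PS : Set c
  PS = ℕ → Carrier

  natCast : ℕ → Carrier
  natCast zero    = 0#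
  natCast (suc n) = natCast n + 1#

  sumTo : ℕ → (ℕ → Carrier) → Carrier
  sumTo zero    f = 0#
  sumTo (suc n) f = sumTo n f + f n

  one : PS
  one zero    = 1#
  one (suc n) = 0#

  _⊛_ : PS → PS → PS
  (a ⊛ b) n = sumTo (suc n) (λ k → a k * b (n ∸ k))

  pow : PS → ℕ → PS
  pow a zero    = one
  pow a (suc m) = a ⊛ pow a m

  xMul : PS → PS
  xMul f zero    = 0#
  xMul f (suc n) = f n

  -- composition  w(h(x))  for h with zero constant term
  -- ([x^n] h^k = 0 for k > n, so the sum is finite)
  comp : PS → PS → PS
  comp w h n = sumTo (suc n) (λ k → w k * pow h k n)

  InF0 : PS → Set ℓ
  InF0 g = ¬ (g 0 ≈ 0#)

  InF1 : PS → Set ℓ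
  InF1 f = (f 0 ≈ 0#) × ¬ (f 1 ≈ 0#)

  Odd : PS → Set ℓ
  Odd f = ∀ j → f (2 *ℕ j) ≈ 0#

  IsSprugnoli : PS → PS → PS → Set ℓ
  IsSprugnoli g f₁ f₂ = InF0 g × InF1 f₁ × InF1 f₂ × Odd f₂

  entry : PS → PS → PS → ℕ → ℕ → Carrier
  entry g f₁ f₂ n k = ((g ⊛ pow f₁ (k % 2)) ⊛ pow (xMul f₂) (k / 2)) n

  -- (g, f₁, f₂) · h ; the matrix is lower triangular (t_{n,k} = 0 for
  -- k > n when f₁, f₂ ∈ 𝓕₁), so the row sum runs over k = 0..n
  act : PS → PS → PS → PS → PS
  act g f₁ f₂ h n = sumTo (suc n) (λ k → entry g f₁ f₂ n k * h k)

  -- w(x) = √x v₂(√x) = Σ_j b_{2j+1} x^{j+1}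
  halfShift : PS → PS
  halfShift v zero    = 0#
  halfShift v (suc j) = v (suc (2 *ℕ j))

CharZero : ∀ {c ℓ} → Field c ℓ → Set ℓ
CharZero K = ∀ n → ¬ (natCast (suc n) ≈ 0#)
  where open Field K
        open PowerSeries commutativeRing

-- Column k + 2j of the Sprugnoli matrix is column k times (x f₂)^j. Hence if D is an
-- even series, D(x) = w(x²), then [x^n] of the image of h D is
-- Σ_{i,j} h_i w_j t_{n,i+2j}, which is also [x^n] of (image of h) · w(x f₂).
-- Since x v₂ is even with w = √x v₂(√x), induction on m gives the theorem.
module Submission where

open import Defs
open import Level using (Level)
open import Data.Nat using (ℕ; zero; suc; _∸_; _≤_; _<_; _≤′_; ≤′-reflexive; ≤′-step; s≤s)
  renaming (_+_ to _+ℕ_; _*_ to _*ℕ_)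
import Data.Nat.Properties as ℕₚ
open import Data.Nat.DivMod using (_/_; _%_; m≡m%n+[m/n]*n; [m+kn]%n≡m%n; +-distrib-/-∣ʳ; m*n/n≡m)
open import Data.Nat.Divisibility using (divides)
open import Data.Product using (_,_)
open import Relation.Nullary using (yes; no)
open import Relation.Binary.PropositionalEquality as ≡ using (_≡_)
open import Algebra.Bundles using (CommutativeRing)
import Algebra.Properties.CommutativeSemigroup as CommutativeSemigroupProperties

+2*-%2 : ∀ i j → (i +ℕ 2 *ℕ j) % 2 ≡ i % 2
+2*-%2 i j = ≡.trans (≡.cong (λ e → (i +ℕ e) % 2) (ℕₚ.*-comm 2 j)) ([m+kn]%n≡m%n i j 2)

+2*-/2 : ∀ i j → (i +ℕ 2 *ℕ j) / 2 ≡ i / 2 +ℕ j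
+2*-/2 i j = ≡.trans (≡.cong (λ e → (i +ℕ e) / 2) (ℕₚ.*-comm 2 j))
  (≡.trans (+-distrib-/-∣ʳ i (divides j ≡.refl)) (≡.cong (i / 2 +ℕ_) (m*n/n≡m j 2)))

%2+/2*2 : ∀ k → k ≡ (k % 2) *ℕ 1 +ℕ (k / 2) *ℕ 2
%2+/2*2 k = ≡.trans (m≡m%n+[m/n]*n k 2) (≡.cong (_+ℕ (k / 2) *ℕ 2) (≡.sym (ℕₚ.*-identityʳ (k % 2))))

∸<⇒<+ : ∀ {i n d} → i ≤ n → n ∸ i < d → n < i +ℕ d
∸<⇒<+ {i} {n} {d} i≤n n∸i<d = ≡.subst (_< i +ℕ d) (ℕₚ.m+[n∸m]≡n i≤n) (ℕₚ.+-monoʳ-< i n∸i<d)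

<+⇒∸< : ∀ {p q k n} → p ≤ k → k ≤ n → n < p +ℕ q → n ∸ k < q
<+⇒∸< {p} {q} {k} {n} p≤k k≤n n<p+q = ℕₚ.+-cancelˡ-< k (n ∸ k) q
  (≡.subst (_< k +ℕ q) (≡.sym (ℕₚ.m+[n∸m]≡n k≤n)) (ℕₚ.<-≤-trans n<p+q (ℕₚ.+-monoˡ-≤ q p≤k)))

module FiniteSums {c ℓ : Level} (R : CommutativeRing c ℓ) where
  open CommutativeRing R
  open PowerSeries R using (sumTo)
  open CommutativeSemigroupProperties +-commutativeSemigroup using (interchange)
  open import Relation.Binary.Reasoning.Setoid setoid

  sumTo-cong : ∀ n {f g : ℕ → Carrier} → (∀ k → k < n → f k ≈ g k) → sumTo n f ≈ sumTo n g
  sumTo-cong zero    f≈g = refl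
  sumTo-cong (suc n) f≈g = +-cong (sumTo-cong n (λ k k<n → f≈g k (ℕₚ.m<n⇒m<1+n k<n))) (f≈g n ℕₚ.≤-refl)

  sumTo-zero : ∀ n {f : ℕ → Carrier} → (∀ k → k < n → f k ≈ 0#) → sumTo n f ≈ 0#
  sumTo-zero zero    f≈0 = refl
  sumTo-zero (suc n) f≈0 =
    trans (+-cong (sumTo-zero n (λ k k<n → f≈0 k (ℕₚ.m<n⇒m<1+n k<n))) (f≈0 n ℕₚ.≤-refl)) (+-identityˡ 0#)

  sumTo-sucˡ : ∀ n (f : ℕ → Carrier) → sumTo (suc n) f ≈ f 0 + sumTo n (λ k → f (suc k))
  sumTo-sucˡ zero    f = trans (+-identityˡ _) (sym (+-identityʳ _))
  sumTo-sucˡ (suc n) f = trans (+-congʳ (sumTo-sucˡ n f)) (+-assoc _ _ _)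

  sumTo-distrib-+ : ∀ n (f g : ℕ → Carrier) → sumTo n (λ k → f k + g k) ≈ sumTo n f + sumTo n g
  sumTo-distrib-+ zero    f g = sym (+-identityˡ 0#)
  sumTo-distrib-+ (suc n) f g = trans (+-congʳ (sumTo-distrib-+ n f g)) (interchange _ _ _ _)

  *-distribˡ-sumTo : ∀ n a (f : ℕ → Carrier) → a * sumTo n f ≈ sumTo n (λ k → a * f k)
  *-distribˡ-sumTo zero    a f = zeroʳ a
  *-distribˡ-sumTo (suc n) a f = trans (distribˡ a _ _) (+-congʳ (*-distribˡ-sumTo n a f))

  *-distribʳ-sumTo : ∀ n a (f : ℕ → Carrier) → sumTo n f * a ≈ sumTo n (λ k → f k * a)
  *-distribʳ-sumTo zero    a f = zeroˡ a
  *-distribʳ-sumTo (suc n) a f = trans (distribʳ a _ _) (+-congʳ (*-distribʳ-sumTo n a f))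

  sumTo-comm : ∀ n m (f : ℕ → ℕ → Carrier) →
    sumTo n (λ i → sumTo m (f i)) ≈ sumTo m (λ j → sumTo n (λ i → f i j))
  sumTo-comm zero    m f = sym (sumTo-zero m (λ _ _ → refl))
  sumTo-comm (suc n) m f = trans (+-congʳ (sumTo-comm n m f)) (sym (sumTo-distrib-+ m _ (f n)))

  sumTo-extend : ∀ {a b} (f : ℕ → Carrier) → a ≤ b → (∀ k → a ≤ k → k < b → f k ≈ 0#) →
    sumTo b f ≈ sumTo a f
  sumTo-extend {a} f a≤b = go (ℕₚ.≤⇒≤′ a≤b)
    where
    go : ∀ {b} → a ≤′ b → (∀ k → a ≤ k → k < b → f k ≈ 0#) → sumTo b f ≈ sumTo a f
    go (≤′-reflexive ≡.refl) _   = refl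
    go {suc b} (≤′-step a≤′b) f≈0 = trans
      (+-cong (go a≤′b (λ k a≤k k<b → f≈0 k a≤k (ℕₚ.m<n⇒m<1+n k<b))) (f≈0 b (ℕₚ.≤′⇒≤ a≤′b) ℕₚ.≤-refl))
      (+-identityʳ _)

  sumTo-pairs : ∀ M (f : ℕ → Carrier) →
    sumTo (2 *ℕ M) f ≈ sumTo M (λ j → f (2 *ℕ j) + f (suc (2 *ℕ j)))
  sumTo-pairs zero    f = refl
  sumTo-pairs (suc M) f rewrite ℕₚ.+-suc M (M +ℕ 0) = trans (+-assoc _ _ _) (+-congʳ (sumTo-pairs M f))

  sumTo-triangle : ∀ n (g : ℕ → ℕ → Carrier) →
    sumTo (suc n) (λ k → sumTo (suc k) (λ i → g i k))
      ≈ sumTo (suc n) (λ i → sumTo (suc (n ∸ i)) (λ d → g i (i +ℕ d)))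
  sumTo-triangle zero    g = refl
  sumTo-triangle (suc n) g = begin
      sumTo (suc n) (λ k → sumTo (suc k) (λ i → g i k)) + sumTo (suc (suc n)) (λ i → g i (suc n))
    ≈⟨ +-congʳ (sumTo-triangle n g) ⟩
      sumTo (suc n) (λ i → rowFrom n i) + (sumTo (suc n) (λ i → g i (suc n)) + g (suc n) (suc n))
    ≈⟨ +-assoc _ _ _ ⟨
      (sumTo (suc n) (λ i → rowFrom n i) + sumTo (suc n) (λ i → g i (suc n))) + g (suc n) (suc n)
    ≈⟨ +-congʳ (sumTo-distrib-+ (suc n) _ _) ⟨
      sumTo (suc n) (λ i → rowFrom n i + g i (suc n)) + g (suc n) (suc n)
    ≈⟨ +-cong (sumTo-cong (suc n) rowFrom-suc) lastRow ⟨
      sumTo (suc n) (λ i → rowFrom (suc n) i) + rowFrom (suc n) (suc n) ∎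
    where
    rowFrom : ℕ → ℕ → Carrier
    rowFrom m i = sumTo (suc (m ∸ i)) (λ d → g i (i +ℕ d))

    rowFrom-suc : ∀ i → i < suc n → rowFrom (suc n) i ≈ rowFrom n i + g i (suc n)
    rowFrom-suc i (s≤s i≤n) rewrite ℕₚ.+-∸-assoc 1 i≤n =
      +-congˡ (reflexive (≡.cong (g i) (≡.trans (ℕₚ.+-suc i (n ∸ i)) (≡.cong suc (ℕₚ.m+[n∸m]≡n i≤n)))))

    lastRow : rowFrom (suc n) (suc n) ≈ g (suc n) (suc n)
    lastRow rewrite ℕₚ.n∸n≡0 n | ℕₚ.+-identityʳ n = +-identityˡ _

module SeriesAlgebra {c ℓ : Level} (R : CommutativeRing c ℓ) where
  open CommutativeRing R
  open PowerSeries R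
  open FiniteSums R
  open CommutativeSemigroupProperties *-commutativeSemigroup using (x∙yz≈y∙xz)
  open import Relation.Binary.Reasoning.Setoid setoid

  ⊛-cong : ∀ {a a′ b b′ : PS} n → (∀ k → k ≤ n → a k ≈ a′ k) → (∀ k → k ≤ n → b k ≈ b′ k) →
    (a ⊛ b) n ≈ (a′ ⊛ b′) n
  ⊛-cong n a≈ b≈ = sumTo-cong (suc n) λ { k (s≤s k≤n) → *-cong (a≈ k k≤n) (b≈ (n ∸ k) (ℕₚ.m∸n≤m n k)) }

  sumTo-⊛-weighted : ∀ n (a b r : PS) →
    sumTo (suc n) (λ k → (a ⊛ b) k * r k)
      ≈ sumTo (suc n) (λ i → a i * sumTo (suc (n ∸ i)) (λ d → b d * r (i +ℕ d)))
  sumTo-⊛-weighted n a b r = begin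
      sumTo (suc n) (λ k → (a ⊛ b) k * r k)
    ≈⟨ sumTo-cong (suc n) (λ k _ → *-distribʳ-sumTo (suc k) (r k) _) ⟩
      sumTo (suc n) (λ k → sumTo (suc k) (λ i → (a i * b (k ∸ i)) * r k))
    ≈⟨ sumTo-triangle n (λ i k → (a i * b (k ∸ i)) * r k) ⟩
      sumTo (suc n) (λ i → sumTo (suc (n ∸ i)) (λ d → (a i * b (i +ℕ d ∸ i)) * r (i +ℕ d)))
    ≈⟨ sumTo-cong (suc n) (λ i _ → begin
         sumTo (suc (n ∸ i)) (λ d → (a i * b (i +ℕ d ∸ i)) * r (i +ℕ d))
       ≈⟨ sumTo-cong (suc (n ∸ i)) (λ d _ →
            trans (*-assoc _ _ _) (*-congˡ (*-congʳ (reflexive (≡.cong b (ℕₚ.m+n∸m≡n i d)))))) ⟩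
         sumTo (suc (n ∸ i)) (λ d → a i * (b d * r (i +ℕ d)))
       ≈⟨ *-distribˡ-sumTo (suc (n ∸ i)) (a i) _ ⟨
         a i * sumTo (suc (n ∸ i)) (λ d → b d * r (i +ℕ d)) ∎) ⟩
      sumTo (suc n) (λ i → a i * sumTo (suc (n ∸ i)) (λ d → b d * r (i +ℕ d))) ∎

  ⊛-assoc : ∀ (a b c : PS) n → ((a ⊛ b) ⊛ c) n ≈ (a ⊛ (b ⊛ c)) n
  ⊛-assoc a b c n = trans (sumTo-⊛-weighted n a b (λ k → c (n ∸ k)))
    (sumTo-cong (suc n) (λ i _ → *-congˡ (sumTo-cong (suc (n ∸ i)) (λ d _ →
      *-congˡ (reflexive (≡.cong c (≡.sym (ℕₚ.∸-+-assoc n i d))))))))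

  ⊛-identityˡ : ∀ (a : PS) n → (one ⊛ a) n ≈ a n
  ⊛-identityˡ a n = trans (sumTo-sucˡ n _)
    (trans (+-cong (*-identityˡ _) (sumTo-zero n (λ k _ → zeroˡ _))) (+-identityʳ _))

  ⊛-identityʳ : ∀ (a : PS) n → (a ⊛ one) n ≈ a n
  ⊛-identityʳ a n = trans
    (+-cong (sumTo-zero n (λ k k<n → trans (*-congˡ (one-pos (n ∸ k) (ℕₚ.m<n⇒0<n∸m k<n))) (zeroʳ _)))
            (*-congˡ (reflexive (≡.cong one (ℕₚ.n∸n≡0 n)))))
    (trans (+-identityˡ _) (*-identityʳ _))
    where
    one-pos : ∀ m → 0 < m → one m ≈ 0#
    one-pos (suc m) _ = refl

  pow-+ : ∀ (a : PS) i j n → pow a (i +ℕ j) n ≈ (pow a i ⊛ pow a j) n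
  pow-+ a zero    j n = sym (⊛-identityˡ (pow a j) n)
  pow-+ a (suc i) j n =
    trans (⊛-cong n (λ _ _ → refl) (λ k _ → pow-+ a i j k)) (sym (⊛-assoc a (pow a i) (pow a j) n))

  ⊛-sumToˡ : ∀ N (c : ℕ → Carrier) (a : ℕ → PS) (b : PS) n →
    ((λ m → sumTo N (λ i → c i * a i m)) ⊛ b) n ≈ sumTo N (λ i → c i * (a i ⊛ b) n)
  ⊛-sumToˡ N c a b n = begin
      sumTo (suc n) (λ k → sumTo N (λ i → c i * a i k) * b (n ∸ k))
    ≈⟨ sumTo-cong (suc n) (λ k _ → *-distribʳ-sumTo N (b (n ∸ k)) _) ⟩
      sumTo (suc n) (λ k → sumTo N (λ i → (c i * a i k) * b (n ∸ k)))
    ≈⟨ sumTo-comm (suc n) N _ ⟩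
      sumTo N (λ i → sumTo (suc n) (λ k → (c i * a i k) * b (n ∸ k)))
    ≈⟨ sumTo-cong N (λ i _ → trans (sumTo-cong (suc n) (λ k _ → *-assoc _ _ _))
                                   (sym (*-distribˡ-sumTo (suc n) (c i) _))) ⟩
      sumTo N (λ i → c i * (a i ⊛ b) n) ∎

  ⊛-sumToʳ : ∀ N (c : ℕ → Carrier) (a : PS) (b : ℕ → PS) n →
    (a ⊛ (λ m → sumTo N (λ j → c j * b j m))) n ≈ sumTo N (λ j → c j * (a ⊛ b j) n)
  ⊛-sumToʳ N c a b n = begin
      sumTo (suc n) (λ k → a k * sumTo N (λ j → c j * b j (n ∸ k)))
    ≈⟨ sumTo-cong (suc n) (λ k _ → *-distribˡ-sumTo N (a k) _) ⟩
      sumTo (suc n) (λ k → sumTo N (λ j → a k * (c j * b j (n ∸ k))))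
    ≈⟨ sumTo-comm (suc n) N _ ⟩
      sumTo N (λ j → sumTo (suc n) (λ k → a k * (c j * b j (n ∸ k))))
    ≈⟨ sumTo-cong N (λ j _ → trans (sumTo-cong (suc n) (λ k _ → x∙yz≈y∙xz _ _ _))
                                   (sym (*-distribˡ-sumTo (suc n) (c j) _))) ⟩
      sumTo N (λ j → c j * (a ⊛ b j) n) ∎

  xMul-2* : ∀ (v : PS) j → xMul v (2 *ℕ j) ≡ halfShift v j
  xMul-2* v zero    = ≡.refl
  xMul-2* v (suc j) = ≡.cong v (ℕₚ.+-suc j (j +ℕ 0))

  VanishesBelow : ℕ → PS → Set ℓ
  VanishesBelow p a = ∀ i → i < p → a i ≈ 0#

  vanishesBelow-1 : ∀ {a : PS} → a 0 ≈ 0# → VanishesBelow 1 a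
  vanishesBelow-1 a0≈0 zero    _             = a0≈0
  vanishesBelow-1 a0≈0 (suc _) (s≤s ())

  ⊛-vanishesBelow : ∀ {p q a b} → VanishesBelow p a → VanishesBelow q b → VanishesBelow (p +ℕ q) (a ⊛ b)
  ⊛-vanishesBelow {p} {q} {a} {b} a≈0 b≈0 n n<p+q = sumTo-zero (suc n) term
    where
    term : ∀ k → k < suc n → a k * b (n ∸ k) ≈ 0#
    term k (s≤s k≤n) with k ℕₚ.<? p
    ... | yes k<p = trans (*-congʳ (a≈0 k k<p)) (zeroˡ _)
    ... | no  k≮p = trans (*-congˡ (b≈0 (n ∸ k) (<+⇒∸< (ℕₚ.≮⇒≥ k≮p) k≤n n<p+q))) (zeroʳ _)

  pow-vanishesBelow : ∀ {p a} → VanishesBelow p a → ∀ q → VanishesBelow (q *ℕ p) (pow a q)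
  pow-vanishesBelow a≈0 zero    _ ()
  pow-vanishesBelow a≈0 (suc q) = ⊛-vanishesBelow a≈0 (pow-vanishesBelow a≈0 q)

  xMul-vanishesBelow : ∀ {p a} → VanishesBelow p a → VanishesBelow (suc p) (xMul a)
  xMul-vanishesBelow a≈0 zero    _         = refl
  xMul-vanishesBelow a≈0 (suc i) (s≤s i<p) = a≈0 i i<p

module SprugnoliAction {c ℓ : Level} (R : CommutativeRing c ℓ) where
  open CommutativeRing R
  open PowerSeries R
  open FiniteSums R
  open SeriesAlgebra R
  open import Relation.Binary.Reasoning.Setoid setoid

  column : PS → PS → PS → ℕ → PS
  column g f₁ f₂ k a = entry g f₁ f₂ a k

  entry-+2* : ∀ g f₁ f₂ i j n →
    entry g f₁ f₂ n (i +ℕ 2 *ℕ j) ≈ (column g f₁ f₂ i ⊛ pow (xMul f₂) j) n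
  entry-+2* g f₁ f₂ i j n = begin
      entry g f₁ f₂ n (i +ℕ 2 *ℕ j)
    ≡⟨ ≡.cong₂ (λ r s → ((g ⊛ pow f₁ r) ⊛ pow F s) n) (+2*-%2 i j) (+2*-/2 i j) ⟩
      ((g ⊛ pow f₁ (i % 2)) ⊛ pow F (i / 2 +ℕ j)) n
    ≈⟨ ⊛-cong n (λ _ _ → refl) (λ k _ → pow-+ F (i / 2) j k) ⟩
      ((g ⊛ pow f₁ (i % 2)) ⊛ (pow F (i / 2) ⊛ pow F j)) n
    ≈⟨ ⊛-assoc (g ⊛ pow f₁ (i % 2)) (pow F (i / 2)) (pow F j) n ⟨
      (column g f₁ f₂ i ⊛ pow F j) n ∎
    where
    F : PS
    F = xMul f₂

  act-cong : ∀ g f₁ f₂ {h h′ : PS} → (∀ k → h k ≈ h′ k) → ∀ n → act g f₁ f₂ h n ≈ act g f₁ f₂ h′ n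
  act-cong g f₁ f₂ h≈h′ n = sumTo-cong (suc n) (λ k _ → *-congˡ (h≈h′ k))

  module _ (g f₁ f₂ : PS) (f₁0≈0 : f₁ 0 ≈ 0#) (f₂0≈0 : f₂ 0 ≈ 0#) where

    entry-lowerTriangular : ∀ {n k} → n < k → entry g f₁ f₂ n k ≈ 0#
    entry-lowerTriangular {n} {k} n<k =
      ⊛-vanishesBelow
        (⊛-vanishesBelow {p = 0} (λ _ ()) (pow-vanishesBelow (vanishesBelow-1 f₁0≈0) (k % 2)))
        (pow-vanishesBelow (xMul-vanishesBelow (vanishesBelow-1 f₂0≈0)) (k / 2))
        n (≡.subst (n <_) (%2+/2*2 k) n<k)

    evenShiftSum : PS → PS → ℕ → Carrier
    evenShiftSum h w n = sumTo (suc n) (λ i → h i * sumTo (suc n) (λ j → w j * entry g f₁ f₂ n (i +ℕ 2 *ℕ j)))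

    act-⊛-even : ∀ (D w : PS) → (∀ j → D (2 *ℕ j) ≈ w j) → (∀ j → D (suc (2 *ℕ j)) ≈ 0#) →
      ∀ h n → act g f₁ f₂ (h ⊛ D) n ≈ evenShiftSum h w n
    act-⊛-even D w D-even D-odd h n = begin
        act g f₁ f₂ (h ⊛ D) n
      ≈⟨ sumTo-cong (suc n) (λ k _ → *-comm _ _) ⟩
        sumTo (suc n) (λ k → (h ⊛ D) k * entry g f₁ f₂ n k)
      ≈⟨ sumTo-⊛-weighted n h D (entry g f₁ f₂ n) ⟩
        sumTo (suc n) (λ i → h i * sumTo (suc (n ∸ i)) (λ d → D d * entry g f₁ f₂ n (i +ℕ d)))
      ≈⟨ sumTo-cong (suc n) (λ { i (s≤s i≤n) → *-congˡ (row i≤n) }) ⟩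
        evenShiftSum h w n ∎
      where
      row : ∀ {i} → i ≤ n →
        sumTo (suc (n ∸ i)) (λ d → D d * entry g f₁ f₂ n (i +ℕ d))
          ≈ sumTo (suc n) (λ j → w j * entry g f₁ f₂ n (i +ℕ 2 *ℕ j))
      row {i} i≤n = begin
          sumTo (suc (n ∸ i)) term
        ≈⟨ sumTo-extend term (ℕₚ.≤-trans (s≤s (ℕₚ.m∸n≤m n i)) (ℕₚ.m≤m+n (suc n) (suc n +ℕ 0)))
             (λ d n∸i<d _ → trans (*-congˡ (entry-lowerTriangular (∸<⇒<+ i≤n n∸i<d))) (zeroʳ _)) ⟨
          sumTo (2 *ℕ suc n) term
        ≈⟨ sumTo-pairs (suc n) term ⟩
          sumTo (suc n) (λ j → term (2 *ℕ j) + term (suc (2 *ℕ j)))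
        ≈⟨ sumTo-cong (suc n) (λ j _ →
             trans (+-cong (*-congʳ (D-even j)) (trans (*-congʳ (D-odd j)) (zeroˡ _))) (+-identityʳ _)) ⟩
          sumTo (suc n) (λ j → w j * entry g f₁ f₂ n (i +ℕ 2 *ℕ j)) ∎
        where
        term : ℕ → Carrier
        term d = D d * entry g f₁ f₂ n (i +ℕ d)

    act-⊛-comp : ∀ (h w : PS) n → (act g f₁ f₂ h ⊛ comp w (xMul f₂)) n ≈ evenShiftSum h w n
    act-⊛-comp h w n = begin
        (act g f₁ f₂ h ⊛ comp w F) n
      ≈⟨ ⊛-cong {b′ = W} n act-truncated comp-truncated ⟩
        ((λ a → sumTo N (λ i → h i * column g f₁ f₂ i a)) ⊛ W) n
      ≈⟨ ⊛-sumToˡ N h (column g f₁ f₂) W n ⟩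
        sumTo N (λ i → h i * (column g f₁ f₂ i ⊛ W) n)
      ≈⟨ sumTo-cong N (λ i _ → *-congˡ (trans (⊛-sumToʳ N w (column g f₁ f₂ i) (pow F) n)
           (sumTo-cong N (λ j _ → *-congˡ (sym (entry-+2* g f₁ f₂ i j n)))))) ⟩
        evenShiftSum h w n ∎
      where
      F : PS
      F = xMul f₂
      N : ℕ
      N = suc n
      W : PS
      W m = sumTo N (λ j → w j * pow F j m)

      act-truncated : ∀ a → a ≤ n → act g f₁ f₂ h a ≈ sumTo N (λ i → h i * entry g f₁ f₂ a i)
      act-truncated a a≤n = trans (sumTo-cong (suc a) (λ _ _ → *-comm _ _))
        (sym (sumTo-extend _ (s≤s a≤n) (λ i a<i _ → trans (*-congˡ (entry-lowerTriangular a<i)) (zeroʳ _))))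

      comp-truncated : ∀ m → m ≤ n → comp w F m ≈ W m
      comp-truncated m m≤n = sym (sumTo-extend _ (s≤s m≤n) (λ j m<j _ →
        trans (*-congˡ (pow-vanishesBelow (xMul-vanishesBelow {0} (λ _ ())) j m
                 (≡.subst (m <_) (≡.sym (ℕₚ.*-identityʳ j)) m<j)))
              (zeroʳ _)))

    act-⊛-pow-even : ∀ (D w : PS) → (∀ j → D (2 *ℕ j) ≈ w j) → (∀ j → D (suc (2 *ℕ j)) ≈ 0#) →
      ∀ m h n → act g f₁ f₂ (h ⊛ pow D m) n ≈ (act g f₁ f₂ h ⊛ pow (comp w (xMul f₂)) m) n
    act-⊛-pow-even D w D-even D-odd zero h n =
      trans (act-cong g f₁ f₂ (⊛-identityʳ h) n) (sym (⊛-identityʳ _ n))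
    act-⊛-pow-even D w D-even D-odd (suc m) h n = begin
        act g f₁ f₂ (h ⊛ (D ⊛ pow D m)) n
      ≈⟨ act-cong g f₁ f₂ (λ k → ⊛-assoc h D (pow D m) k) n ⟨
        act g f₁ f₂ ((h ⊛ D) ⊛ pow D m) n
      ≈⟨ act-⊛-pow-even D w D-even D-odd m (h ⊛ D) n ⟩
        (act g f₁ f₂ (h ⊛ D) ⊛ pow Q m) n
      ≈⟨ ⊛-cong {b = pow Q m} n (λ k _ → trans (act-⊛-even D w D-even D-odd h k) (sym (act-⊛-comp h w k))) (λ _ _ → refl) ⟩
        ((act g f₁ f₂ h ⊛ Q) ⊛ pow Q m) n
      ≈⟨ ⊛-assoc (act g f₁ f₂ h) Q (pow Q m) n ⟩
        (act g f₁ f₂ h ⊛ (Q ⊛ pow Q m)) n ∎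
      where
      Q : PS
      Q = comp w (xMul f₂)

-- Only f₁(0) = f₂(0) = 0 and the oddness of v₂ are needed.
mainTheorem4 : ∀ {c ℓ : Level} (K : Field c ℓ) → CharZero K →
    let open Field K
        open PowerSeries commutativeRing
    in (g f₁ f₂ u v₁ v₂ : PS) →
       IsSprugnoli g f₁ f₂ → IsSprugnoli u v₁ v₂ → (m : ℕ) →
       ∀ n → act g f₁ f₂ (u ⊛ pow (xMul v₂) m) n
             ≈ (act g f₁ f₂ u ⊛ pow (comp (halfShift v₂) (xMul f₂)) m) n
mainTheorem4 K _ g f₁ f₂ u v₁ v₂ (_ , (f₁0≈0 , _) , (f₂0≈0 , _) , _) (_ , _ , _ , v₂-odd) m n =
  act-⊛-pow-even g f₁ f₂ f₁0≈0 f₂0≈0 (xMul v₂) (halfShift v₂) (λ j → reflexive (xMul-2* v₂ j)) v₂-odd m u n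
  where
  open Field K using (commutativeRing; reflexive)
  open PowerSeries commutativeRing using (xMul; halfShift)
  open SeriesAlgebra commutativeRing using (xMul-2*)
  open SprugnoliAction commutativeRing using (act-⊛-pow-even)
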